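{- Let $n\ge 11$ and $T_{n,2}=\frac{n(n+1)}{2}-2$. Then $\#\mathbb U^*_{T_{n,2}}=1$.
   Context: A partition of $N$ into distinct parts is a sequence of positive integers $\lambda_1<\dots<\lambda_t$ summing to $N$ with $t\ge 2$. Its missing parts are the elements of $\{1,\dots,\lambda_t\}\setminus\{\lambda_1,\dots,\lambda_t\}$. $\lambda$ is refinable if two distinct missing parts sum to a part of $\lambda$, unrefinable otherwise; $\mathbb U_N$ is the set of unrefinable partitions of $N$. $\mathbb U^*_N$ is the set of $\lambda\in\mathbb U_N$ whose largest part is the maximum of the largest parts over all of $\mathbb U_N$. Standing assumption: $n\ge 11$. -}

module Defs where

open import Data.Nat using (ℕ; _+_; _*_; _∸_; _≤_; _<_; _⊔_; suc)
open import Data.Nat.DivMod using (_/_)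
open import Data.List using (List; length; foldr)
open import Data.Nat.ListAction using (sum)
open import Data.List.Relation.Unary.All using (All)
open import Data.List.Relation.Unary.Linked using (Linked)
open import Data.List.Membership.Propositional using (_∈_; _∉_)
open import Data.Product using (_×_; ∃-syntax)
open import Relation.Binary.PropositionalEquality using (_≡_; _≢_)
open import Relation.Nullary using (¬_)

record IsDistinctPartition (N : ℕ) (λs : List ℕ) : Set where
  field
    increasing : Linked _<_ λs
    positive   : All (λ x → 1 ≤ x) λs
    sums       : sum λs ≡ N
    atLeastTwo : 2 ≤ length λs

largest : List ℕ → ℕ
largest = foldr _⊔_ 0

Missing : List ℕ → ℕ → Set
Missing λs m = (1 ≤ m) × (m ≤ largest λs) × (m ∉ λs)

Refinable : List ℕ → Set
Refinable λs = ∃[ a ] ∃[ b ] (a ≢ b × Missing λs a × Missing λs b × (a + b) ∈ λs)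

Unrefinable : List ℕ → Set
Unrefinable λs = ¬ Refinable λs

InU : ℕ → List ℕ → Set
InU N λs = IsDistinctPartition N λs × Unrefinable λs

InUStar : ℕ → List ℕ → Set
InUStar N λs = InU N λs × (∀ μs → InU N μs → largest μs ≤ largest λs)

T₂ : ℕ → ℕ
T₂ n = (n * suc n) / 2 ∸ 2

{-# OPTIONS --safe #-}
-- Write n = m + 2, so that T₂ n = (1 + ⋯ + m) + (2m + 1). Let L ≥ 2m + 1 be the largest part of an
-- unrefinable partition μ. For each i ≤ m the values i < L − i sum to the part L, so they are not both
-- missing; as the pairs {i, L − i} are disjoint, sum μ ≥ (1 + ⋯ + m) + L. For a partition of T₂ n this
-- gives L ≤ 2m + 1, which is attained by the unrefinable partition {1, …, m, 2m + 1}. When L = 2m + 1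
-- the bound is tight, so no L − i is a part (it would contribute more than i); hence every i ≤ m is a
-- part and μ = {1, …, m, 2m + 1}.
module Submission where

open import Defs
open import Data.Bool using (true; if_then_else_)
open import Data.Empty using (⊥-elim)
open import Data.List using (List; []; _∷_; _∷ʳ_; applyUpTo; length)
open import Data.List.Membership.Propositional using (_∈_; _∉_)
open import Data.List.Membership.Propositional.Properties
  using (∈-++⁺ˡ; ∈-++⁺ʳ; ∈-++⁻; ∈-applyUpTo⁺; ∈-applyUpTo⁻)
open import Data.List.Properties using (length-++; length-applyUpTo; foldr-preservesᵇ)
open import Data.List.Relation.Binary.Subset.Propositional using (_⊆_)
open import Data.List.Relation.Unary.All as All using (All; []; _∷_)
open import Data.List.Relation.Unary.All.Properties as All using ()
open import Data.List.Relation.Unary.AllPairs using ([]; _∷_)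
open import Data.List.Relation.Unary.AllPairs.Properties as AllPairs using ()
open import Data.List.Relation.Unary.Any using (here; there)
open import Data.List.Relation.Unary.Linked as Linked using (Linked; [-]; _∷_)
open import Data.List.Relation.Unary.Linked.Properties using (Linked⇒All; AllPairs⇒Linked)
open import Data.Nat
open import Data.Nat.DivMod using (m*n/n≡m)
open import Data.Nat.ListAction using (sum)
open import Data.Nat.ListAction.Properties using (sum-++)
open import Data.Nat.Properties
open import Data.Nat.Tactic.RingSolver using (solve-∀)
open import Data.Product using (_×_; _,_; ∃-syntax)
open import Data.Sum using (_⊎_; inj₁; inj₂)
open import Function using (_∘_)
open import Relation.Binary.PropositionalEquality
open import Relation.Nullary using (yes; no)

open import Algebra.Properties.CommutativeSemigroup +-commutativeSemigroup using (interchange)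
open import Data.List.Membership.DecPropositional _≟_ using (_∈?_)

∑ : ℕ → (ℕ → ℕ) → ℕ
∑ n f = sum (applyUpTo f n)

∑-zero : ∀ n → ∑ n (λ _ → 0) ≡ 0
∑-zero zero    = refl
∑-zero (suc n) = ∑-zero n

∑-snoc : ∀ n f → ∑ (suc n) f ≡ ∑ n f + f n
∑-snoc zero    f = +-comm (f 0) 0
∑-snoc (suc n) f = begin
  f 0 + ∑ (suc n) (f ∘ suc)         ≡⟨ cong (f 0 +_) (∑-snoc n (f ∘ suc)) ⟩
  f 0 + (∑ n (f ∘ suc) + f (suc n)) ≡⟨ +-assoc (f 0) _ _ ⟨
  ∑ (suc n) f + f (suc n)           ∎
  where open ≡-Reasoning

∑-split : ∀ m n f → ∑ (m + n) f ≡ ∑ m f + ∑ n (λ i → f (m + i))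
∑-split zero    n f = refl
∑-split (suc m) n f = trans (cong (f 0 +_) (∑-split m n (f ∘ suc))) (sym (+-assoc (f 0) _ _))

∑-distrib-+ : ∀ n f g → ∑ n (λ i → f i + g i) ≡ ∑ n f + ∑ n g
∑-distrib-+ zero    f g = refl
∑-distrib-+ (suc n) f g = begin
  (f 0 + g 0) + ∑ n (λ i → f (suc i) + g (suc i)) ≡⟨ cong (f 0 + g 0 +_) (∑-distrib-+ n (f ∘ suc) (g ∘ suc)) ⟩
  (f 0 + g 0) + (∑ n (f ∘ suc) + ∑ n (g ∘ suc))   ≡⟨ interchange (f 0) (g 0) _ _ ⟩
  (f 0 + ∑ n (f ∘ suc)) + (g 0 + ∑ n (g ∘ suc))   ∎
  where open ≡-Reasoning

∑-reverse : ∀ n f → ∑ n (λ i → f (n ∸ suc i)) ≡ ∑ n f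
∑-reverse zero    f = refl
∑-reverse (suc n) f = begin
  f n + ∑ n (λ i → f (n ∸ suc i)) ≡⟨ cong (f n +_) (∑-reverse n f) ⟩
  f n + ∑ n f                     ≡⟨ +-comm (f n) _ ⟩
  ∑ n f + f n                     ≡⟨ ∑-snoc n f ⟨
  ∑ (suc n) f                     ∎
  where open ≡-Reasoning

∑-mono-≤ : ∀ n {f g} → (∀ {i} → i < n → f i ≤ g i) → ∑ n f ≤ ∑ n g
∑-mono-≤ zero    f≤g = z≤n
∑-mono-≤ (suc n) f≤g = +-mono-≤ (f≤g z<s) (∑-mono-≤ n (f≤g ∘ s<s))

∑-mono-< : ∀ n {f g} → (∀ {i} → i < n → f i ≤ g i) → ∀ {i} → i < n → f i < g i → ∑ n f < ∑ n g
∑-mono-< (suc n) f≤g {zero}  _         f<g = +-mono-<-≤ f<g (∑-mono-≤ n (f≤g ∘ s<s))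
∑-mono-< (suc n) f≤g {suc i} (s<s i<n) f<g = +-mono-≤-< (f≤g z<s) (∑-mono-< n (f≤g ∘ s<s) i<n f<g)

-- x times its multiplicity in xs: summed over a range of values it recovers sum xs.
weight : List ℕ → ℕ → ℕ
weight []       x = 0
weight (y ∷ ys) x = (if x ≡ᵇ y then y else 0) + weight ys x

∑-indicator : ∀ {n} y c → y < n → ∑ n (λ x → if x ≡ᵇ y then c else 0) ≡ c
∑-indicator {suc n} zero    c _         = trans (cong (c +_) (∑-zero n)) (+-identityʳ c)
∑-indicator {suc n} (suc y) c (s<s y<n) = ∑-indicator y c y<n

sum≡∑-weight : ∀ {n} xs → All (_< n) xs → sum xs ≡ ∑ n (weight xs)
sum≡∑-weight {n} []       []              = sym (∑-zero n)
sum≡∑-weight {n} (y ∷ ys) (y<n ∷ ys<n) = begin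
  y + sum ys                                            ≡⟨ cong₂ _+_ (sym (∑-indicator y y y<n)) (sum≡∑-weight ys ys<n) ⟩
  ∑ n (λ x → if x ≡ᵇ y then y else 0) + ∑ n (weight ys) ≡⟨ ∑-distrib-+ n _ (weight ys) ⟨
  ∑ n (weight (y ∷ ys))                                 ∎
  where open ≡-Reasoning

weight-≥ : ∀ {x xs} → x ∈ xs → x ≤ weight xs x
weight-≥ {x} (here refl) with x ≡ᵇ x | ≡⇒≡ᵇ x x refl
... | true | _ = m≤m+n x _
weight-≥ {x} {y ∷ _} (there x∈xs) = ≤-trans (weight-≥ x∈xs) (m≤n+m _ (if x ≡ᵇ y then y else 0))

≤-largest : ∀ {x xs} → x ∈ xs → x ≤ largest xs
≤-largest {xs = y ∷ ys} (here refl)  = m≤m⊔n y (largest ys)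
≤-largest {xs = y ∷ ys} (there x∈ys) = ≤-trans (≤-largest x∈ys) (m≤n⊔m y (largest ys))

largest∈ : ∀ x xs → largest (x ∷ xs) ∈ x ∷ xs
largest∈ x []       = here (⊔-identityʳ x)
largest∈ x (y ∷ ys) with ⊔-sel x (largest (y ∷ ys))
... | inj₁ x⊔≡x = here x⊔≡x
... | inj₂ x⊔≡L = there (subst (_∈ y ∷ ys) (sym x⊔≡L) (largest∈ y ys))

largest-≤ : ∀ {b xs} → All (_≤ b) xs → largest xs ≤ b
largest-≤ = foldr-preservesᵇ ⊔-lub z≤n

head<tail : ∀ {x xs} → Linked _<_ (x ∷ xs) → All (x <_) xs
head<tail [-]           = []
head<tail (x<y ∷ y∷ys↗) = Linked⇒All <-trans x<y y∷ys↗

module _ {x y xs ys} (xs↗ : Linked _<_ (x ∷ xs)) (ys↗ : Linked _<_ (y ∷ ys)) where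

  strictlySorted-⊆-head : x ∷ xs ⊆ y ∷ ys → y ∷ ys ⊆ x ∷ xs → x ≡ y
  strictlySorted-⊆-head xs⊆ys ys⊆xs with xs⊆ys (here refl) | ys⊆xs (here refl)
  ... | here x≡y   | _          = x≡y
  ... | there _    | here y≡x   = sym y≡x
  ... | there x∈ys | there y∈xs =
    ⊥-elim (<-asym (All.lookup (head<tail ys↗) x∈ys) (All.lookup (head<tail xs↗) y∈xs))

  strictlySorted-⊆-tail : x ≡ y → x ∷ xs ⊆ y ∷ ys → xs ⊆ ys
  strictlySorted-⊆-tail refl xs⊆ys v∈xs with xs⊆ys (there v∈xs)
  ... | here refl  = ⊥-elim (<-irrefl refl (All.lookup (head<tail xs↗) v∈xs))
  ... | there v∈ys = v∈ys

strictlySorted-⊆-antisym : ∀ {xs ys} → Linked _<_ xs → Linked _<_ ys → xs ⊆ ys → ys ⊆ xs → xs ≡ ys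
strictlySorted-⊆-antisym {[]}     {[]}     _   _   _     _     = refl
strictlySorted-⊆-antisym {[]}     {_ ∷ _}  _   _   _     ys⊆xs with () ← ys⊆xs (here refl)
strictlySorted-⊆-antisym {_ ∷ _}  {[]}     _   _   xs⊆ys _     with () ← xs⊆ys (here refl)
strictlySorted-⊆-antisym {x ∷ xs} {y ∷ ys} xs↗ ys↗ xs⊆ys ys⊆xs
  with x≡y@refl ← strictlySorted-⊆-head xs↗ ys↗ xs⊆ys ys⊆xs =
  cong (x ∷_) (strictlySorted-⊆-antisym (Linked.tail xs↗) (Linked.tail ys↗)
                 (strictlySorted-⊆-tail xs↗ ys↗ x≡y xs⊆ys) (strictlySorted-⊆-tail ys↗ xs↗ x≡y ys⊆xs))

open IsDistinctPartition

largest∈parts : ∀ {N μ} → IsDistinctPartition N μ → largest μ ∈ μ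
largest∈parts {μ = x ∷ xs} _ = largest∈ x xs
largest∈parts {μ = []}     P with () ← atLeastTwo P

unrefinable-pair : ∀ {μ x y} → Unrefinable μ → x + y ∈ μ → 1 ≤ x → x < y → x ∈ μ ⊎ y ∈ μ
unrefinable-pair {μ} {x} {y} unref x+y∈μ 1≤x x<y with x ∈? μ | y ∈? μ
... | yes x∈μ | _       = inj₁ x∈μ
... | no _    | yes y∈μ = inj₂ y∈μ
... | no x∉μ  | no y∉μ  = ⊥-elim (unref (x , y , <⇒≢ x<y ,
      (1≤x , ≤-trans (m≤m+n x y) x+y≤L , x∉μ) ,
      (≤-trans 1≤x (<⇒≤ x<y) , ≤-trans (m≤n+m y x) x+y≤L , y∉μ) , x+y∈μ))
  where
  x+y≤L : x + y ≤ largest μ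
  x+y≤L = ≤-largest x+y∈μ

module Pairing (m r : ℕ) where

  top : ℕ
  top = r + suc (m + m)

  partner : ℕ → ℕ
  partner i = suc m + (r + (m ∸ suc i))

  suc+partner≡top : ∀ {i} → i < m → suc i + partner i ≡ top
  suc+partner≡top {i} i<m = begin
    suc i + (suc m + (r + (m ∸ suc i))) ≡⟨ rearrange (suc i) m r (m ∸ suc i) ⟩
    r + suc (m + (m ∸ suc i + suc i))   ≡⟨ cong (λ k → r + suc (m + k)) (m∸n+n≡m i<m) ⟩
    top                                 ∎
    where
    open ≡-Reasoning
    rearrange : ∀ a m r k → a + (suc m + (r + k)) ≡ r + suc (m + (k + a))
    rearrange = solve-∀

  suc<partner : ∀ {i} → i < m → suc i < partner i
  suc<partner i<m = s≤s (≤-trans i<m (m≤m+n _ _))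

  ∑-pairs+top≤∑ : ∀ w → ∑ m (λ i → w (suc i) + w (partner i)) + w top ≤ ∑ (suc top) w
  ∑-pairs+top≤∑ w = begin
    ∑ m (λ i → w (suc i) + w (partner i)) + w top   ≡⟨ cong (_+ w top) (∑-distrib-+ m (w ∘ suc) (w ∘ partner)) ⟩
    (∑ m (w ∘ suc) + ∑ m (w ∘ partner)) + w top     ≡⟨ cong (λ s → (∑ m (w ∘ suc) + s) + w top) (∑-reverse m upper) ⟩
    (∑ m (w ∘ suc) + ∑ m upper) + w top             ≤⟨ +-monoˡ-≤ (w top) (+-mono-≤ (m≤n+m _ (w 0)) (m≤n+m _ middle)) ⟩
    (∑ (suc m) w + (middle + ∑ m upper)) + w top    ≡⟨ cong (_+ w top) blocks ⟨
    ∑ (suc m + (r + m)) w + w top                   ≡⟨ cong (λ n → ∑ n w + w top) (layout m r) ⟩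
    ∑ top w + w top                                 ≡⟨ ∑-snoc top w ⟨
    ∑ (suc top) w                                   ∎
    where
    open ≤-Reasoning
    upper : ℕ → ℕ
    upper j = w (suc m + (r + j))
    middle : ℕ
    middle = ∑ r (λ i → w (suc m + i))
    blocks : ∑ (suc m + (r + m)) w ≡ ∑ (suc m) w + (middle + ∑ m upper)
    blocks = trans (∑-split (suc m) (r + m) w) (cong (∑ (suc m) w +_) (∑-split r m (λ i → w (suc m + i))))
    layout : ∀ m r → suc m + (r + m) ≡ r + suc (m + m)
    layout = solve-∀

  partner-surjective : ∀ {z} → r + suc m ≤ z → z < top → ∃[ i ] i < m × partner i ≡ z
  partner-surjective {z} lo z<top = m ∸ suc j , ∸-suc<self j<m , (begin
    suc m + (r + (m ∸ suc (m ∸ suc j))) ≡⟨ cong (λ k → suc m + (r + k)) (∸-suc-involutive j<m) ⟩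
    suc m + (r + j)                     ≡⟨ rearrange m r j ⟩
    j + (r + suc m)                     ≡⟨ m∸n+n≡m lo ⟩
    z                                   ∎)
    where
    open ≡-Reasoning
    j : ℕ
    j = z ∸ (r + suc m)
    rearrange : ∀ m r j → suc m + (r + j) ≡ j + (r + suc m)
    rearrange = solve-∀
    top≡ : ∀ m r → r + suc (m + m) ≡ m + (r + suc m)
    top≡ = solve-∀
    j<m : j < m
    j<m = +-cancelʳ-< (r + suc m) j m (subst₂ _<_ (sym (m∸n+n≡m lo)) (top≡ m r) z<top)
    ∸-suc-involutive : ∀ {j m} → j < m → m ∸ suc (m ∸ suc j) ≡ j
    ∸-suc-involutive {m = suc m} (s≤s j≤m) = m∸[m∸n]≡n j≤m
    ∸-suc<self : ∀ {j m} → j < m → m ∸ suc j < m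
    ∸-suc<self {j} {suc m} _ = s≤s (m∸n≤m m j)

  module _ {N μ} (P : IsDistinctPartition N μ) (unref : Unrefinable μ) (L≡top : largest μ ≡ top) where

    top∈μ : top ∈ μ
    top∈μ = subst (_∈ μ) L≡top (largest∈parts P)

    suc∈μ⊎partner∈μ : ∀ {i} → i < m → suc i ∈ μ ⊎ partner i ∈ μ
    suc∈μ⊎partner∈μ i<m =
      unrefinable-pair unref (subst (_∈ μ) (sym (suc+partner≡top i<m)) top∈μ) (s≤s z≤n) (suc<partner i<m)

    pairWeight : ℕ → ℕ
    pairWeight i = weight μ (suc i) + weight μ (partner i)

    pairWeight-> : ∀ {i} → i < m → partner i ∈ μ → suc i < pairWeight i
    pairWeight-> i<m partner∈μ =
      <-≤-trans (suc<partner i<m) (≤-trans (weight-≥ partner∈μ) (m≤n+m _ _))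

    pairWeight-≥ : ∀ {i} → i < m → suc i ≤ pairWeight i
    pairWeight-≥ i<m with suc∈μ⊎partner∈μ i<m
    ... | inj₁ suc∈μ     = ≤-trans (weight-≥ suc∈μ) (m≤m+n _ _)
    ... | inj₂ partner∈μ = <⇒≤ (pairWeight-> i<m partner∈μ)

    ∑-pairWeight+top≤N : ∑ m pairWeight + top ≤ N
    ∑-pairWeight+top≤N = begin
      ∑ m pairWeight + top            ≤⟨ +-monoʳ-≤ (∑ m pairWeight) (weight-≥ top∈μ) ⟩
      ∑ m pairWeight + weight μ top   ≤⟨ ∑-pairs+top≤∑ (weight μ) ⟩
      ∑ (suc top) (weight μ)          ≡⟨ sum≡∑-weight μ parts<suc-top ⟨
      sum μ                           ≡⟨ sums P ⟩
      N                               ∎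
      where
      open ≤-Reasoning
      parts<suc-top : All (_< suc top) μ
      parts<suc-top = All.tabulate (λ x∈μ → s≤s (subst (_ ≤_) L≡top (≤-largest x∈μ)))

    ∑suc+top≤N : ∑ m suc + top ≤ N
    ∑suc+top≤N = ≤-trans (+-monoˡ-≤ top (∑-mono-≤ m pairWeight-≥)) ∑-pairWeight+top≤N

    ∑suc+top<N : ∀ {i} → i < m → partner i ∈ μ → ∑ m suc + top < N
    ∑suc+top<N i<m partner∈μ =
      <-≤-trans (+-monoˡ-< top (∑-mono-< m pairWeight-≥ i<m (pairWeight-> i<m partner∈μ)))
                ∑-pairWeight+top≤N

∑-suc*2 : ∀ m → ∑ m suc * 2 ≡ m * suc m
∑-suc*2 zero    = refl
∑-suc*2 (suc m) = begin
  ∑ (suc m) suc * 2           ≡⟨ cong (_* 2) (∑-snoc m suc) ⟩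
  (∑ m suc + suc m) * 2       ≡⟨ *-distribʳ-+ 2 (∑ m suc) (suc m) ⟩
  ∑ m suc * 2 + suc m * 2     ≡⟨ cong (_+ suc m * 2) (∑-suc*2 m) ⟩
  m * suc m + suc m * 2       ≡⟨ gauss-step m ⟩
  suc m * suc (suc m)         ∎
  where
  open ≡-Reasoning
  gauss-step : ∀ m → m * suc m + suc m * 2 ≡ suc m * suc (suc m)
  gauss-step = solve-∀

T₂-≡ : ∀ m → T₂ (suc (suc m)) ≡ ∑ m suc + suc (m + m)
T₂-≡ m = begin
  (suc (suc m) * suc (suc (suc m))) / 2 ∸ 2 ≡⟨ cong (λ k → k / 2 ∸ 2) double ⟩
  ((t + 2) * 2) / 2 ∸ 2                     ≡⟨ cong (_∸ 2) (m*n/n≡m (t + 2) 2) ⟩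
  t + 2 ∸ 2                                 ≡⟨ m+n∸n≡m t 2 ⟩
  t                                         ∎
  where
  open ≡-Reasoning
  t : ℕ
  t = ∑ m suc + suc (m + m)
  double : suc (suc m) * suc (suc (suc m)) ≡ (t + 2) * 2
  double = begin
    suc (suc m) * suc (suc (suc m)) ≡⟨ expand m ⟩
    m * suc m + (4 * m + 6)         ≡⟨ cong (_+ (4 * m + 6)) (∑-suc*2 m) ⟨
    ∑ m suc * 2 + (4 * m + 6)       ≡⟨ regroup (∑ m suc) m ⟩
    (t + 2) * 2                     ∎
    where
    expand : ∀ m → suc (suc m) * suc (suc (suc m)) ≡ m * suc m + (4 * m + 6)
    expand = solve-∀
    regroup : ∀ s m → s * 2 + (4 * m + 6) ≡ (s + suc (m + m) + 2) * 2
    regroup = solve-∀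

canonical : ℕ → List ℕ
canonical m = applyUpTo suc m ∷ʳ suc (m + m)

module _ {m : ℕ} where

  ∈-canonical⁺ : ∀ {z} → 1 ≤ z → z ≤ m → z ∈ canonical m
  ∈-canonical⁺ {suc i} _ i<m = ∈-++⁺ˡ (∈-applyUpTo⁺ suc i<m)

  top∈canonical : suc (m + m) ∈ canonical m
  top∈canonical = ∈-++⁺ʳ (applyUpTo suc m) (here refl)

  ∈-canonical⁻ : ∀ {z} → z ∈ canonical m → (∃[ i ] i < m × z ≡ suc i) ⊎ z ≡ suc (m + m)
  ∈-canonical⁻ z∈ with ∈-++⁻ (applyUpTo suc m) z∈
  ... | inj₁ z∈upTo    = inj₁ (∈-applyUpTo⁻ suc z∈upTo)
  ... | inj₂ (here z≡) = inj₂ z≡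

  canonical-increasing : Linked _<_ (canonical m)
  canonical-increasing = AllPairs⇒Linked (AllPairs.++⁺
    (AllPairs.applyUpTo⁺₁ suc m (λ i<j _ → s<s i<j))
    ([] ∷ [])
    (All.applyUpTo⁺₁ suc m (λ i<m → s<s (≤-trans i<m (m≤m+n m m)) ∷ [])))

  canonical-largest : largest (canonical m) ≡ suc (m + m)
  canonical-largest = ≤-antisym (largest-≤ (All.tabulate ≤top)) (≤-largest top∈canonical)
    where
    ≤top : ∀ {z} → z ∈ canonical m → z ≤ suc (m + m)
    ≤top z∈ with ∈-canonical⁻ z∈
    ... | inj₁ (i , i<m , refl) = ≤-trans i<m (m≤n+m m (suc m))
    ... | inj₂ refl             = ≤-refl

  canonical-unrefinable : Unrefinable (canonical m)
  canonical-unrefinable (a , b , _ , (1≤a , _ , a∉) , (1≤b , _ , b∉) , a+b∈) =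
    <⇒≱ (s≤s (≤-reflexive (sym (+-suc m m))))
        (≤-trans (+-mono-≤ (missing>m 1≤a a∉) (missing>m 1≤b b∉))
                 (subst (a + b ≤_) canonical-largest (≤-largest a+b∈)))
    where
    missing>m : ∀ {x} → 1 ≤ x → x ∉ canonical m → m < x
    missing>m 1≤x x∉ = ≰⇒> (λ x≤m → x∉ (∈-canonical⁺ 1≤x x≤m))

  canonical-∈U : 1 ≤ m → InU (T₂ (suc (suc m))) (canonical m)
  canonical-∈U 1≤m = partition , canonical-unrefinable
    where
    partition : IsDistinctPartition (T₂ (suc (suc m))) (canonical m)
    partition = record
      { increasing = canonical-increasing
      ; positive   = All.tabulate ≥1
      ; sums       = trans (sum-++ (applyUpTo suc m) _)
                       (trans (cong (∑ m suc +_) (+-identityʳ _)) (sym (T₂-≡ m)))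
      ; atLeastTwo = subst (2 ≤_) (sym length≡) (+-monoˡ-≤ 1 1≤m)
      }
      where
      ≥1 : ∀ {z} → z ∈ canonical m → 1 ≤ z
      ≥1 z∈ with ∈-canonical⁻ z∈
      ... | inj₁ (i , _ , refl) = s≤s z≤n
      ... | inj₂ refl           = s≤s z≤n
      length≡ : length (canonical m) ≡ m + 1
      length≡ = trans (length-++ (applyUpTo suc m)) (cong (_+ 1) (length-applyUpTo suc m))

InU⇒largest≤ : ∀ m {μ} → InU (T₂ (suc (suc m))) μ → largest μ ≤ suc (m + m)
InU⇒largest≤ m {μ} (P , unref) with ≤-total (suc (m + m)) (largest μ)
... | inj₂ L≤top = L≤top
... | inj₁ top≤L = +-cancelˡ-≤ (∑ m suc) _ _ (begin
  ∑ m suc + largest μ         ≡⟨ cong (∑ m suc +_) L≡top ⟩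
  ∑ m suc + top               ≤⟨ ∑suc+top≤N P unref L≡top ⟩
  T₂ (suc (suc m))            ≡⟨ T₂-≡ m ⟩
  ∑ m suc + suc (m + m)       ∎)
  where
  open ≤-Reasoning
  open Pairing m (largest μ ∸ suc (m + m))
  L≡top : largest μ ≡ top
  L≡top = sym (m∸n+n≡m top≤L)

canonical-∈U* : ∀ {m} → 1 ≤ m → InUStar (T₂ (suc (suc m))) (canonical m)
canonical-∈U* {m} 1≤m = canonical-∈U 1≤m ,
  λ μ μ∈U → subst (largest μ ≤_) (sym (canonical-largest {m})) (InU⇒largest≤ m μ∈U)

∈U*⇒≡canonical : ∀ {m μ} → 1 ≤ m → InUStar (T₂ (suc (suc m))) μ → μ ≡ canonical m
∈U*⇒≡canonical {m} {μ} 1≤m ((P , unref) , maximal) =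
  strictlySorted-⊆-antisym (increasing P) (canonical-increasing {m}) μ⊆canonical canonical⊆μ
  where
  open Pairing m 0
  L≡top : largest μ ≡ top
  L≡top = ≤-antisym (InU⇒largest≤ m (P , unref))
    (subst (_≤ largest μ) (canonical-largest {m}) (maximal (canonical m) (canonical-∈U 1≤m)))
  partner∉μ : ∀ {i} → i < m → partner i ∉ μ
  partner∉μ i<m partner∈μ = <-irrefl (sym (T₂-≡ m)) (∑suc+top<N P unref L≡top i<m partner∈μ)
  suc∈μ : ∀ {i} → i < m → suc i ∈ μ
  suc∈μ i<m with suc∈μ⊎partner∈μ P unref L≡top i<m
  ... | inj₁ suc∈μ     = suc∈μ
  ... | inj₂ partner∈μ = ⊥-elim (partner∉μ i<m partner∈μ)
  canonical⊆μ : canonical m ⊆ μ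
  canonical⊆μ z∈ with ∈-canonical⁻ z∈
  ... | inj₁ (i , i<m , refl) = suc∈μ i<m
  ... | inj₂ refl             = top∈μ P unref L≡top
  μ⊆canonical : μ ⊆ canonical m
  μ⊆canonical {z} z∈μ with z ≤? m | z ≟ top
  ... | yes z≤m | _        = ∈-canonical⁺ (All.lookup (positive P) z∈μ) z≤m
  ... | no _    | yes refl = top∈canonical
  ... | no z≰m  | no z≢top
    with partner-surjective (≰⇒> z≰m) (≤∧≢⇒< (subst (z ≤_) L≡top (≤-largest z∈μ)) z≢top)
  ...   | i , i<m , refl = ⊥-elim (partner∉μ i<m z∈μ)

corollary2p9 : (n : ℕ) → 11 ≤ n →
    ∃[ λs ] (InUStar (T₂ n) λs × (∀ μs → InUStar (T₂ n) μs → μs ≡ λs))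
corollary2p9 (suc (suc m)) (s≤s (s≤s 9≤m)) =
  canonical m , canonical-∈U* 1≤m , λ μ μ∈U* → ∈U*⇒≡canonical 1≤m μ∈U*
  where
  1≤m : 1 ≤ m
  1≤m = ≤-trans (s≤s z≤n) 9≤m
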